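{- For every function $h:\mathbb N^2\to\mathbb N$ there is an infinite set $D\subseteq\mathbb N$ such that either (i) there is $M\in\mathbb N$ with $h(x,y)\le M$ for all $x<y$ in $D$, or (ii) there is a function $g:\mathbb N\to\mathbb N$ with $\liminf_{n\to\infty}g(n)=+\infty$ such that $h(x,y)>g(x)$ for all $x<y$ in $D$. -}

module Defs where

open import Data.Nat using (ℕ; _≤_; _<_)
open import Data.Product using (∃-syntax; _×_)

-- A subset D ⊆ ℕ (as a predicate) is infinite iff it is unbounded.
Infinite : (ℕ → Set) → Set
Infinite D = ∀ n → ∃[ m ] (n ≤ m × D m)

-- liminf_{n→∞} g(n) = +∞, i.e. g(n) → +∞.
LiminfInfinite : (ℕ → ℕ) → Set
LiminfInfinite g = ∀ K → ∃[ N ] (∀ n → N ≤ n → K ≤ g n)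

ForAllPairs : (ℕ → Set) → (ℕ → ℕ → Set) → Set
ForAllPairs D P = ∀ x y → D x → D y → x < y → P x y

-- If h is bounded by some M along an increasing sequence, the range of that sequence gives (i).
-- Otherwise, for every k, every infinite S contains a point x with k < h x y for infinitely many
-- y ∈ S above x: if there were none, each x ∈ S would have a bound past which k < h x y fails,
-- and choosing points of S greedily past these bounds would give a sequence along which h ≤ k.
-- Choosing such points d 0, d 1, … from a nested sequence of infinite sets yields an increasing d
-- with i < h (d i) (d j) for i < j, and (ii) holds on its range with g n the largest i with d i ≤ n.
module Submission where

open import Defs
open import Level using (0ℓ)
open import Axiom.ExcludedMiddle using (ExcludedMiddle)
open import Axiom.DoubleNegationElimination using (em⇒dne)
open import Data.Nat using (ℕ; zero; suc; _≤_; _<_; _≤′_; ≤′-reflexive; ≤′-step; _⊔_; z≤n; s≤s; _≤?_)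
open import Data.Nat.Properties
open import Data.Product using (Σ; ∃-syntax; _×_; _,_; proj₁; proj₂)
open import Data.Sum using (_⊎_; inj₁; inj₂)
open import Data.Unit using (⊤; tt)
open import Relation.Binary.Core using (_Preserves_⟶_)
open import Relation.Binary.PropositionalEquality using (_≡_; refl)
open import Relation.Nullary using (¬_; yes; no; contradiction)

StrictlyIncreasing : (ℕ → ℕ) → Set
StrictlyIncreasing f = f Preserves _<_ ⟶ _<_

module _ {f : ℕ → ℕ} where

  stepwise⇒strictlyIncreasing : (∀ i → f i < f (suc i)) → StrictlyIncreasing f
  stepwise⇒strictlyIncreasing step i<j = go (≤⇒≤′ i<j)
    where
    go : ∀ {i j} → suc i ≤′ j → f i < f j
    go (≤′-reflexive refl) = step _
    go (≤′-step p)         = <-trans (go p) (step _)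

  module _ (f↑ : StrictlyIncreasing f) where

    strictlyIncreasing⇒monotone : f Preserves _≤_ ⟶ _≤_
    strictlyIncreasing⇒monotone i≤j with m≤n⇒m<n∨m≡n i≤j
    ... | inj₁ i<j  = <⇒≤ (f↑ i<j)
    ... | inj₂ refl = ≤-refl

    f-reflects-≤ : ∀ {i j} → f i ≤ f j → i ≤ j
    f-reflects-≤ fi≤fj = ≮⇒≥ λ j<i → <⇒≱ (f↑ j<i) fi≤fj

    f-reflects-< : ∀ {i j} → f i < f j → i < j
    f-reflects-< fi<fj = ≰⇒> λ j≤i → <⇒≱ fi<fj (strictlyIncreasing⇒monotone j≤i)

    i≤f[i] : ∀ i → i ≤ f i
    i≤f[i] zero    = z≤n
    i≤f[i] (suc i) = <-≤-trans (s≤s (i≤f[i] i)) (f↑ (n<1+n i))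

Image : (ℕ → ℕ) → ℕ → Set
Image f y = ∃[ i ] (f i ≡ y)

module _ {f : ℕ → ℕ} (f↑ : StrictlyIncreasing f) where

  image-infinite : Infinite (Image f)
  image-infinite n = f n , i≤f[i] f↑ n , n , refl

  image-forAllPairs : {P : ℕ → ℕ → Set} →
    (∀ {i j} → i < j → P (f i) (f j)) → ForAllPairs (Image f) P
  image-forAllPairs pairs _ _ (i , refl) (j , refl) fi<fj = pairs (f-reflects-< f↑ fi<fj)

Finite : (ℕ → Set) → Set
Finite P = ∃[ n ] (∀ m → n ≤ m → ¬ P m)

¬infinite⇒finite : ExcludedMiddle 0ℓ → {P : ℕ → Set} → ¬ Infinite P → Finite P
¬infinite⇒finite em ¬inf = dne λ ¬fin →
  ¬inf λ n → dne λ ¬beyond → ¬fin (n , λ m n≤m Pm → ¬beyond (m , n≤m , Pm))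
  where dne = em⇒dne em

module _ {S : ℕ → Set} (inf : Infinite S) (B : (x : ℕ) → S x → ℕ) where

  private
    pick : ℕ → Σ ℕ S
    pick n = proj₁ (inf n) , proj₂ (proj₂ (inf n))

    beyond : Σ ℕ S → ℕ
    beyond (x , s) = suc x ⊔ B x s

    e : ℕ → Σ ℕ S
    e zero    = pick 0
    e (suc i) = pick (beyond (e i))

    beyond≤next : ∀ i → beyond (e i) ≤ proj₁ (e (suc i))
    beyond≤next i = proj₁ (proj₂ (inf (beyond (e i))))

    next-above : ∀ i → proj₁ (e i) < proj₁ (e (suc i))
    next-above i = ≤-trans (m≤m⊔n _ (B _ (proj₂ (e i)))) (beyond≤next i)

    next-beyond-B : ∀ i → B (proj₁ (e i)) (proj₂ (e i)) ≤ proj₁ (e (suc i))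
    next-beyond-B i = ≤-trans (m≤n⊔m (suc (proj₁ (e i))) _) (beyond≤next i)

  greedySequence : ∃[ f ] Σ (∀ i → S (f i)) λ f∈S →
    StrictlyIncreasing f × (∀ {i j} → i < j → B (f i) (f∈S i) ≤ f j)
  greedySequence = f , f∈S , f↑ , bound
    where
    f : ℕ → ℕ
    f i = proj₁ (e i)

    f∈S : ∀ i → S (f i)
    f∈S i = proj₂ (e i)

    f↑ : StrictlyIncreasing f
    f↑ = stepwise⇒strictlyIncreasing next-above

    bound : ∀ {i j} → i < j → B (f i) (f∈S i) ≤ f j
    bound {i} i<j = ≤-trans (next-beyond-B i) (strictlyIncreasing⇒monotone f↑ i<j)

module _ (R : ℕ → ℕ → ℕ → Set)
         (choose : ∀ k {S} → Infinite S → ∃[ x ] (S x × Infinite (λ y → S y × R k x y))) where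

  iteratedChoice : ∃[ d ] (∀ {i j} → i < j → R i (d i) (d j))
  iteratedChoice = d , λ {i} {j} i<j → proj₂ (stage-antitone (≤⇒≤′ i<j) (d∈stage j))
    where
    stage : ℕ → Σ (ℕ → Set) Infinite
    Stage : ℕ → ℕ → Set
    Stage k = proj₁ (stage k)
    d : ℕ → ℕ
    d k = proj₁ (choose k (proj₂ (stage k)))

    stage zero    = (λ _ → ⊤) , λ n → n , ≤-refl , tt
    stage (suc k) = (λ y → Stage k y × R k (d k) y) , proj₂ (proj₂ (choose k (proj₂ (stage k))))

    d∈stage : ∀ k → Stage k (d k)
    d∈stage k = proj₁ (proj₂ (choose k (proj₂ (stage k))))

    stage-antitone : ∀ {i j y} → i ≤′ j → Stage j y → Stage i y
    stage-antitone (≤′-reflexive refl) s = s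
    stage-antitone (≤′-step i≤′j)      s = stage-antitone i≤′j (proj₁ s)

-- The largest j ≤ k with d j ≤ n, and 0 if there is none.
lastIndex : (ℕ → ℕ) → ℕ → ℕ → ℕ
lastIndex d n zero = 0
lastIndex d n (suc k) with d (suc k) ≤? n
... | yes _ = suc k
... | no _  = lastIndex d n k

module _ (d : ℕ → ℕ) (n : ℕ) where

  lastIndex-≤ : ∀ {i} → (∀ j → d j ≤ n → j ≤ i) → ∀ k → lastIndex d n k ≤ i
  lastIndex-≤ below zero = z≤n
  lastIndex-≤ below (suc k) with d (suc k) ≤? n
  ... | yes dk≤n = below (suc k) dk≤n
  ... | no _     = lastIndex-≤ below k

  ≤-lastIndex : ∀ {K} → d K ≤ n → ∀ {k} → K ≤ k → K ≤ lastIndex d n k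
  ≤-lastIndex dK≤n {zero}  z≤n = z≤n
  ≤-lastIndex dK≤n {suc k} K≤k with d (suc k) ≤? n
  ... | yes _ = K≤k
  ... | no dk≰n with m≤n⇒m<n∨m≡n K≤k
  ...   | inj₁ K<1+k = ≤-lastIndex dK≤n (≤-pred K<1+k)
  ...   | inj₂ refl  = contradiction dK≤n dk≰n

lowerInverse : {d : ℕ → ℕ} → StrictlyIncreasing d →
  ∃[ g ] (LiminfInfinite g × ∀ i → g (d i) ≤ i)
lowerInverse {d} d↑ = g , g→∞ , λ i → lastIndex-≤ d (d i) (λ j → f-reflects-≤ d↑) (d i)
  where
  g : ℕ → ℕ
  g n = lastIndex d n n

  g→∞ : LiminfInfinite g
  g→∞ K = d K , λ n dK≤n → ≤-lastIndex d n dK≤n (≤-trans (i≤f[i] d↑ K) dK≤n)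

module _ (h : ℕ → ℕ → ℕ) where

  BoundedAlongSequence : Set
  BoundedAlongSequence = ∃[ M ] ∃[ f ] (StrictlyIncreasing f × (∀ {i j} → i < j → h (f i) (f j) ≤ M))

  Large : ℕ → ℕ → ℕ → Set
  Large k x y = x < y × k < h x y

  largeFromSomePoint : ExcludedMiddle 0ℓ → ¬ BoundedAlongSequence → ∀ k {S} → Infinite S →
    ∃[ x ] (S x × Infinite (λ y → S y × Large k x y))
  largeFromSomePoint em unbounded k {S} inf = em⇒dne em λ noPoint →
    let f , f∈S , f↑ , past-bound = greedySequence inf (λ x s → proj₁ (fin noPoint x s))
    in unbounded (k , f , f↑ , λ {i} {j} i<j → ≮⇒≥ λ large →
         proj₂ (fin noPoint (f i) (f∈S i)) (f j) (past-bound i<j) (f∈S j , f↑ i<j , large))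
    where
    fin : ¬ (∃[ x ] (S x × Infinite (λ y → S y × Large k x y))) →
          (x : ℕ) → S x → Finite (λ y → S y × Large k x y)
    fin noPoint x s = ¬infinite⇒finite em λ large → noPoint (x , s , large)

  largeSequence⇒liminfCase : {d : ℕ → ℕ} → (∀ {i j} → i < j → Large i (d i) (d j)) →
    ∃[ D ] (Infinite D × ∃[ g ] (LiminfInfinite g × ForAllPairs D (λ x y → g x < h x y)))
  largeSequence⇒liminfCase {d} large =
    let g , g→∞ , g∘d≤id = lowerInverse d↑
    in Image d , image-infinite d↑ , g , g→∞ , image-forAllPairs d↑
         λ {i} i<j → ≤-<-trans (g∘d≤id i) (proj₂ (large i<j))
    where
    d↑ : StrictlyIncreasing d
    d↑ i<j = proj₁ (large i<j)

lemma5p5 : ExcludedMiddle 0ℓ → (h : ℕ → ℕ → ℕ) →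
    ∃[ D ] (Infinite D ×
    ((∃[ M ] ForAllPairs D (λ x y → h x y ≤ M))
    ⊎ (∃[ g ] (LiminfInfinite g × ForAllPairs D (λ x y → g x < h x y)))))
lemma5p5 em h with em {BoundedAlongSequence h}
... | yes (M , f , f↑ , bounded) =
  Image f , image-infinite f↑ , inj₁ (M , image-forAllPairs f↑ bounded)
... | no unbounded =
  let D , D-infinite , liminfCase = largeSequence⇒liminfCase h
        (proj₂ (iteratedChoice (Large h) (largeFromSomePoint h em unbounded)))
  in D , D-infinite , inj₂ liminfCase
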